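{- If $T$ is a (finite) tree, then $\mathrm{MOF}_k(T) = \alpha(T)$ for all positive integers $k$.
   Context: An orientation $D$ of a simple graph $G$ assigns to each edge exactly one direction; if $(u,v)$ is an arc, $v$ is an out-neighbor of $u$. Oriented $k$-forcing: starting from a nonempty set $S$ of colored vertices, repeatedly, any colored vertex having at most $k$ non-colored out-neighbors forces all of them to become colored (all forcings in a step simultaneous), until no change occurs; $S$ is a $k$-forcing set if all vertices end up colored. $F_k(D)$ is the minimum size of a $k$-forcing set of $D$, and $\mathrm{MOF}_k(G)$ is the maximum of $F_k(D)$ over all orientations $D$ of $G$. $\alpha(T)$ is the independence number of $T$. -}

module Defs where

open import Data.Nat using (ℕ; zero; suc; _+_; _≤_; _≤ᵇ_)
open import Data.Fin using (Fin; zero; suc)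
open import Data.Fin.Subset using (Subset; _∈_; ∣_∣; Nonempty)
open import Data.Bool using (Bool; true; false; _∧_; _∨_; not; _xor_)
open import Data.Vec using (Vec; lookup; tabulate)
open import Data.List using (allFin)
open import Data.Bool.ListAction using (any)
open import Data.Product using (Σ; ∃; _×_; _,_)
open import Data.Empty using (⊥)
open import Function.Definitions using (Injective)
open import Relation.Binary.PropositionalEquality using (_≡_; _≢_)

record Graph (n : ℕ) : Set where
  field
    adj   : Fin n → Fin n → Bool
    sym   : ∀ u v → adj u v ≡ adj v u
    irref : ∀ u → adj u u ≡ false

open Graph public

data Walk {n : ℕ} (G : Graph n) : Fin n → Fin n → Set where
  here : ∀ {u} → Walk G u u
  step : ∀ {u w v} → adj G u w ≡ true → Walk G w v → Walk G u v

Connected : ∀ {n} → Graph n → Set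
Connected G = ∀ u v → Walk G u v

record Cycle {n : ℕ} (G : Graph n) : Set where
  field
    len      : ℕ
    verts    : Vec (Fin n) (suc (suc (suc len)))
    distinct : Injective _≡_ _≡_ (lookup verts)
    consec   : ∀ (i : Fin (suc (suc len))) →
               adj G (lookup verts (Data.Fin.inject₁ i)) (lookup verts (suc i)) ≡ true
    closing  : adj G (lookup verts (Data.Fin.fromℕ (suc (suc len)))) (lookup verts zero) ≡ true

Acyclic : ∀ {n} → Graph n → Set
Acyclic G = Cycle G → ⊥

IsTree : ∀ {n} → Graph n → Set
IsTree {n} G = (1 ≤ n) × Connected G × Acyclic G

Independent : ∀ {n} → Graph n → Subset n → Set
Independent G I = ∀ u v → u ∈ I → v ∈ I → adj G u v ≡ false

IsIndependenceNumber : ∀ {n} → Graph n → ℕ → Set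
IsIndependenceNumber G a =
  (Σ (Subset _) λ I → Independent G I × ∣ I ∣ ≡ a) ×
  (∀ I → Independent G I → ∣ I ∣ ≤ a)

-- Orientations: arc D u v = true means (u , v) is an arc.

IsOrientation : ∀ {n} → Graph n → (Fin n → Fin n → Bool) → Set
IsOrientation G D =
  (∀ u v → D u v ≡ true → adj G u v ≡ true) ×
  (∀ u v → adj G u v ≡ true → (D u v xor D v u) ≡ true)

uncoloredOut : ∀ {n} → (Fin n → Fin n → Bool) → Subset n → Fin n → ℕ
uncoloredOut D C u = ∣ tabulate (λ w → D u w ∧ not (lookup C w)) ∣

forceStep : ∀ {n} → (Fin n → Fin n → Bool) → ℕ → Subset n → Subset n
forceStep {n} D k C = tabulate λ v →
  lookup C v ∨ any (λ u → lookup C u ∧ D u v ∧ (uncoloredOut D C u ≤ᵇ k)) (allFin n)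

iterate : ∀ {A : Set} → (A → A) → ℕ → A → A
iterate f zero    x = x
iterate f (suc t) x = f (iterate f t x)

allColored : ∀ {n} → Subset n → Set
allColored {n} C = ∀ (v : Fin n) → v ∈ C

IsForcingSet : ∀ {n} → (Fin n → Fin n → Bool) → ℕ → Subset n → Set
IsForcingSet D k S = Nonempty S × ∃ λ t → allColored (iterate (forceStep D k) t S)

IsFk : ∀ {n} → (Fin n → Fin n → Bool) → ℕ → ℕ → Set
IsFk D k m =
  (Σ (Subset _) λ S → IsForcingSet D k S × ∣ S ∣ ≡ m) ×
  (∀ S → IsForcingSet D k S → m ≤ ∣ S ∣)

IsMOF : ∀ {n} → Graph n → ℕ → ℕ → Set
IsMOF {n} G k m =
  (Σ (Fin n → Fin n → Bool) λ D → IsOrientation G D × IsFk D k m) ×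
  (∀ D → IsOrientation G D → ∀ m′ → IsFk D k m′ → m′ ≤ m)

-- Lower bound: orient every edge at a vertex of a maximum independent set I away from it
-- (and the other edges arbitrarily). The vertices of I then have no in-arcs, so they can
-- never be forced, and every forcing set contains I.
-- Upper bound, for any orientation of a forest and k ≥ 1: delete a leaf v together with
-- its neighbour u, and let S′ force the rest with |S′| ≤ |I′| for an independent set I′.
-- Add the tail of the arc between u and v to S′. If the tail is v, it forces u, its only
-- out-neighbour. As v is adjacent to nothing but u, S′ then colours everything except v,
-- and if the tail is u, u finally forces v. Since I′ ∪ {v} is independent, induction gives
-- a forcing set no larger than an independent set.

module Submission where

open import Defs hiding (sym)
open import Data.Nat using (ℕ; zero; suc; _+_; _≤_; _<_; _≤ᵇ_; _<ᵇ_; z≤n; s≤s; s≤s⁻¹)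
open import Data.Nat.Properties
open import Data.Nat.Induction using (<-wellFounded)
open import Data.Fin using (Fin; toℕ; inject₁; fromℕ; fromℕ<)
import Data.Fin.Properties as Fin
open import Data.Fin.Subset
open import Data.Fin.Subset.Properties
open import Data.Bool using (Bool; true; false; T; _∧_; _∨_; not; _xor_; if_then_else_)
open import Data.Bool.Properties using (T-≡; T-∧; T-∨; ∧-conicalˡ; ∧-zeroʳ; xor-identityʳ; ¬-not)
  renaming (_≟_ to _≟ᵇ_)
open import Data.Bool.ListAction using (any)
open import Data.List using (allFin)
open import Data.List.Membership.Propositional using (lose)
open import Data.List.Membership.Propositional.Properties using (∈-allFin)
open import Data.List.Relation.Unary.Any using (satisfied)
open import Data.List.Relation.Unary.Any.Properties using (any⁺; any⁻)
open import Data.Vec using ([]; _∷_; lookup; tabulate; here; there)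
open import Data.Vec.Properties using (lookup∘tabulate; lookup⇒[]=; []=⇒lookup)
open import Data.Product using (Σ; ∃-syntax; _×_; _,_; proj₁; proj₂)
open import Data.Sum using (_⊎_; inj₁; inj₂; [_,_]′)
open import Data.Empty using (⊥-elim)
open import Function using (_∘_; id; Equivalence)
open import Induction.WellFounded using (Acc; acc)
open import Relation.Nullary using (¬_; Dec; yes; no; contradiction)
open import Relation.Nullary.Decidable using (_×-dec_; ¬?; toSum; decidable-stable)
open import Relation.Binary.PropositionalEquality

private
  variable
    n : ℕ

x∈p─q⇒x∉q : ∀ {x : Fin n} (p q : Subset n) → x ∈ p ─ q → x ∉ q
x∈p─q⇒x∉q (_ ∷ _) (inside  ∷ _) ()        here
x∈p─q⇒x∉q (_ ∷ p) (_       ∷ q) (there x∈) (there x∈q) = x∈p─q⇒x∉q p q x∈ x∈q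

∣p∪q∣≤∣p∣+∣q∣ : ∀ (p q : Subset n) → ∣ p ∪ q ∣ ≤ ∣ p ∣ + ∣ q ∣
∣p∪q∣≤∣p∣+∣q∣ []            []            = z≤n
∣p∪q∣≤∣p∣+∣q∣ (outside ∷ p) (outside ∷ q) = ∣p∪q∣≤∣p∣+∣q∣ p q
∣p∪q∣≤∣p∣+∣q∣ (outside ∷ p) (inside  ∷ q) =
  ≤-trans (s≤s (∣p∪q∣≤∣p∣+∣q∣ p q)) (≤-reflexive (sym (+-suc ∣ p ∣ ∣ q ∣)))
∣p∪q∣≤∣p∣+∣q∣ (inside  ∷ p) (outside ∷ q) = s≤s (∣p∪q∣≤∣p∣+∣q∣ p q)
∣p∪q∣≤∣p∣+∣q∣ (inside  ∷ p) (inside  ∷ q) =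
  s≤s (≤-trans (∣p∪q∣≤∣p∣+∣q∣ p q) (+-monoʳ-≤ ∣ p ∣ (n≤1+n ∣ q ∣)))

tabulate-∈⁺ : ∀ {f : Fin n → Bool} {x} → f x ≡ true → x ∈ tabulate f
tabulate-∈⁺ {f = f} {x} fx = lookup⇒[]= x _ (trans (lookup∘tabulate f x) fx)

tabulate-∈⁻ : ∀ {f : Fin n → Bool} {x} → x ∈ tabulate f → f x ≡ true
tabulate-∈⁻ {f = f} {x} x∈ = trans (sym (lookup∘tabulate f x)) ([]=⇒lookup x∈)

∉⇒lookup≡false : ∀ {p : Subset n} {x} → x ∉ p → lookup p x ≡ false
∉⇒lookup≡false x∉p = ¬-not (x∉p ∘ lookup⇒[]= _ _)

lookup≡false⇒∉ : ∀ {p : Subset n} {x} → lookup p x ≡ false → x ∉ p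
lookup≡false⇒∉ px≡false x∈p with () ← trans (sym ([]=⇒lookup x∈p)) px≡false

module _ (f : Subset n → Subset n) (inflationary : ∀ C → C ⊆ f C) where

  ⊆-iterate : ∀ t S → S ⊆ iterate f t S
  ⊆-iterate zero    S = id
  ⊆-iterate (suc t) S = inflationary (iterate f t S) ∘ ⊆-iterate t S

  ReachesFixpoint : Subset n → Set
  ReachesFixpoint S = ∃[ t ] f (iterate f t S) ⊆ iterate f t S

  fixed⊎grows : ∀ C → f C ⊆ C ⊎ ∣ C ∣ < ∣ f C ∣
  fixed⊎grows C with C ⊂? f C
  ... | yes C⊂fC = inj₂ (p⊂q⇒∣p∣<∣q∣ C⊂fC)
  ... | no  C⊄fC = inj₁ λ {x} x∈fC →
    decidable-stable (x ∈? C) λ x∉C → C⊄fC (inflationary C , x , x∈fC , x∉C)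

  fixpoint⊎growth : ∀ S t → ReachesFixpoint S ⊎ t ≤ ∣ iterate f t S ∣
  fixpoint⊎growth S zero = inj₂ z≤n
  fixpoint⊎growth S (suc t) with fixpoint⊎growth S t | fixed⊎grows (iterate f t S)
  ... | inj₁ fixpoint | _              = inj₁ fixpoint
  ... | inj₂ _        | inj₁ fixed     = inj₁ (t , fixed)
  ... | inj₂ t≤∣C∣    | inj₂ ∣C∣<∣fC∣ = inj₂ (<-≤-trans (s≤s t≤∣C∣) ∣C∣<∣fC∣)

  inflationary⇒fixpoint : ∀ S → ReachesFixpoint S
  inflationary⇒fixpoint S with fixpoint⊎growth S (suc n)
  ... | inj₁ fixpoint = fixpoint
  ... | inj₂ n<∣C∣    = ⊥-elim (1+n≰n (≤-trans n<∣C∣ (∣p∣≤n (iterate f (suc n) S))))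

module _ {n : ℕ} (G : Graph n) where

  adj⇒≢ : ∀ {u v} → adj G u v ≡ true → u ≢ v
  adj⇒≢ {u} uv refl with () ← trans (sym uv) (irref G u)

  adj-sym : ∀ {u v} → adj G u v ≡ true → adj G v u ≡ true
  adj-sym {u} {v} uv = trans (Graph.sym G v u) uv

  HasEdgeIn : Subset n → Set
  HasEdgeIn W = ∃[ u ] ∃[ v ] u ∈ W × v ∈ W × adj G u v ≡ true

  hasEdgeIn? : ∀ W → Dec (HasEdgeIn W)
  hasEdgeIn? W = Fin.any? λ u → Fin.any? λ v → u ∈? W ×-dec v ∈? W ×-dec adj G u v ≟ᵇ true

  record PendantEdge (W : Subset n) : Set where
    field
      {stem leaf} : Fin n
      stem∈W      : stem ∈ W
      leaf∈W      : leaf ∈ W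
      stem~leaf   : adj G stem leaf ≡ true
      leaf-only   : ∀ {w} → w ∈ W → adj G leaf w ≡ true → w ≡ stem

  -- Only the vertices at indices i ≤ m belong to the path.
  record Path (W : Subset n) (m : ℕ) : Set where
    field
      vertex    : ℕ → Fin n
      vertex∈W  : ∀ {i} → i ≤ m → vertex i ∈ W
      adjacent  : ∀ {i} → i < m → adj G (vertex i) (vertex (suc i)) ≡ true
      injective : ∀ {i j} → i ≤ m → j ≤ m → vertex i ≡ vertex j → i ≡ j

  open Path

  path-length< : ∀ {W m} → Path W m → m < n
  path-length< p = Fin.injective⇒≤ {f = vertex p ∘ toℕ} λ {i} {j} eq →
    Fin.toℕ-injective (injective p (s≤s⁻¹ (Fin.toℕ<n i)) (s≤s⁻¹ (Fin.toℕ<n j)) eq)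

  singleton : ∀ {W v} → v ∈ W → Path W 0
  singleton {v = v} v∈W = record
    { vertex    = λ _ → v
    ; vertex∈W  = λ _ → v∈W
    ; adjacent  = λ ()
    ; injective = λ { z≤n z≤n _ → refl }
    }

  truncate : ∀ {W m j} → j ≤ m → Path W m → Path W j
  truncate j≤m p = record
    { vertex    = vertex p
    ; vertex∈W  = λ i≤j → vertex∈W p (≤-trans i≤j j≤m)
    ; adjacent  = λ i<j → adjacent p (<-≤-trans i<j j≤m)
    ; injective = λ i≤j i′≤j → injective p (≤-trans i≤j j≤m) (≤-trans i′≤j j≤m)
    }

  prepend : ∀ {W m y} (p : Path W m) → y ∈ W → adj G y (vertex p 0) ≡ true →
           (∀ {i} → i ≤ m → vertex p i ≢ y) → Path W (suc m)
  prepend {W} {m} {y} p y∈W y~p₀ fresh = record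
    { vertex    = vertex′
    ; vertex∈W  = λ { {zero} _ → y∈W ; {suc i} i≤ → vertex∈W p (s≤s⁻¹ i≤) }
    ; adjacent  = λ { {zero} _ → y~p₀ ; {suc i} i< → adjacent p (s≤s⁻¹ i<) }
    ; injective = injective′
    }
    where
    vertex′ : ℕ → Fin n
    vertex′ zero    = y
    vertex′ (suc i) = vertex p i
    injective′ : ∀ {i j} → i ≤ suc m → j ≤ suc m → vertex′ i ≡ vertex′ j → i ≡ j
    injective′ {zero}  {zero}  _  _  _  = refl
    injective′ {zero}  {suc j} _  j≤ eq = ⊥-elim (fresh (s≤s⁻¹ j≤) (sym eq))
    injective′ {suc i} {zero}  i≤ _  eq = ⊥-elim (fresh (s≤s⁻¹ i≤) eq)
    injective′ {suc i} {suc j} i≤ j≤ eq = cong suc (injective p (s≤s⁻¹ i≤) (s≤s⁻¹ j≤) eq)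

  closePath : ∀ {W len} (p : Path W (suc (suc len))) →
              adj G (vertex p (suc (suc len))) (vertex p 0) ≡ true → Cycle G
  closePath {len = len} p closing = record
    { len      = len
    ; verts    = tabulate (vertex p ∘ toℕ)
    ; distinct = λ {i} {j} eq → Fin.toℕ-injective
        (injective p (s≤s⁻¹ (Fin.toℕ<n i)) (s≤s⁻¹ (Fin.toℕ<n j))
          (trans (sym (lookup-verts i)) (trans eq (lookup-verts j))))
    ; consec   = λ i → subst₂ (λ a b → adj G a b ≡ true)
        (sym (trans (lookup-verts (inject₁ i)) (cong (vertex p) (Fin.toℕ-inject₁ i))))
        (sym (lookup-verts (Data.Fin.suc i)))
        (adjacent p (Fin.toℕ<n i))
    ; closing  = subst₂ (λ a b → adj G a b ≡ true)
        (sym (trans (lookup-verts (fromℕ _)) (cong (vertex p) (Fin.toℕ-fromℕ _))))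
        (sym (lookup-verts Data.Fin.zero))
        closing
    }
    where
    lookup-verts : ∀ i → lookup (tabulate (vertex p ∘ toℕ)) i ≡ vertex p (toℕ i)
    lookup-verts = lookup∘tabulate (vertex p ∘ toℕ)

  onPath? : ∀ {W m} (p : Path W m) y → Dec (∃[ j ] j ≤ m × vertex p j ≡ y)
  onPath? {m = m} p y with Fin.any? {n = suc m} (λ j → vertex p (toℕ j) Fin.≟ y)
  ... | yes (j , eq) = yes (toℕ j , s≤s⁻¹ (Fin.toℕ<n j) , eq)
  ... | no  none     = no λ (j , j≤m , eq) →
    none (fromℕ< (s≤s j≤m) , trans (cong (vertex p) (Fin.toℕ-fromℕ< (s≤s j≤m))) eq)

  module _ (acyclic : Acyclic G) {W : Subset n} where

    -- Walking away from a path's far end: each new neighbour of vertex 0 other than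
    -- vertex 1 either closes a cycle or extends the path, which cannot grow past n.
    pendantFromPath : ∀ {m} fuel → n ≤ m + fuel → Path W (suc m) → PendantEdge W
    pendantFromPath {m} fuel n≤ p
      with Fin.any? (λ y → y ∈? W ×-dec adj G (vertex p 0) y ≟ᵇ true ×-dec ¬? (y Fin.≟ vertex p 1))
    ... | no noOther = record
      { stem∈W    = vertex∈W p (s≤s z≤n)
      ; leaf∈W    = vertex∈W p z≤n
      ; stem~leaf = adj-sym (adjacent p (s≤s z≤n))
      ; leaf-only = λ {w} w∈W p₀~w → decidable-stable (w Fin.≟ vertex p 1)
          λ w≢p₁ → noOther (w , w∈W , p₀~w , w≢p₁)
      }
    ... | yes (y , y∈W , p₀~y , y≢p₁) with onPath? p y
    ...   | yes (zero , _ , eq)              = ⊥-elim (adj⇒≢ p₀~y eq)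
    ...   | yes (suc zero , _ , eq)          = ⊥-elim (y≢p₁ (sym eq))
    ...   | yes (suc (suc len) , j≤ , eq)    = ⊥-elim (acyclic
              (closePath (truncate j≤ p) (subst (λ a → adj G a (vertex p 0) ≡ true) (sym eq) (adj-sym p₀~y))))
    ...   | no offPath with fuel
    ...     | zero      = ⊥-elim (<⇒≱ (path-length< p)
                    (≤-trans n≤ (≤-trans (≤-reflexive (+-identityʳ m)) (n≤1+n m))))
    ...     | suc fuel′ = pendantFromPath fuel′ (≤-trans n≤ (≤-reflexive (+-suc m fuel′)))
                (prepend p y∈W (adj-sym p₀~y) λ i≤ eq → offPath (_ , i≤ , eq))

    acyclic⇒pendantEdge : HasEdgeIn W → PendantEdge W
    acyclic⇒pendantEdge (u , v , u∈W , v∈W , u~v) =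
      pendantFromPath n (m≤n+m n 0) (prepend (singleton v∈W) u∈W u~v λ { z≤n → adj⇒≢ u~v ∘ sym })

module Forcing {n : ℕ} (D : Fin n → Fin n → Bool) (k : ℕ) where

  private
    T⇒≡ : ∀ {b} → T b → b ≡ true
    T⇒≡ = Equivalence.to T-≡
    ≡⇒T : ∀ {b} → b ≡ true → T b
    ≡⇒T = Equivalence.from T-≡

  UncoloredOut : Subset n → Fin n → Subset n
  UncoloredOut X z = tabulate λ w → D z w ∧ not (lookup X w)

  ∈-UncoloredOut⁺ : ∀ {X z w} → D z w ≡ true → w ∉ X → w ∈ UncoloredOut X z
  ∈-UncoloredOut⁺ {X} {z} {w} zw w∉X =
    tabulate-∈⁺ (subst₂ (λ a b → a ∧ not b ≡ true) (sym zw) (sym (∉⇒lookup≡false w∉X)) refl)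

  ∈-UncoloredOut⁻ : ∀ {X z w} → w ∈ UncoloredOut X z → D z w ≡ true × w ∉ X
  ∈-UncoloredOut⁻ {X} {z} {w} w∈ with D z w | lookup X w in eq | tabulate-∈⁻ w∈
  ... | true | false | _ = refl , lookup≡false⇒∉ eq

  uncoloredOut-mono : ∀ {X Y z} → (∀ {w} → D z w ≡ true → w ∉ X → w ∉ Y) →
                      uncoloredOut D X z ≤ uncoloredOut D Y z
  uncoloredOut-mono X⊇Y = p⊆q⇒∣p∣≤∣q∣ λ w∈ →
    let zw , w∉X = ∈-UncoloredOut⁻ w∈ in ∈-UncoloredOut⁺ zw (X⊇Y zw w∉X)

  uncoloredOut≤1 : ∀ {X z} x → (∀ {w} → D z w ≡ true → w ∉ X → w ≡ x) → uncoloredOut D X z ≤ 1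
  uncoloredOut≤1 x only-x = ≤-trans (p⊆q⇒∣p∣≤∣q∣ λ w∈ →
    let zw , w∉X = ∈-UncoloredOut⁻ w∈ in subst (_∈ ⁅ x ⁆) (sym (only-x zw w∉X)) (x∈⁅x⁆ x))
    (≤-reflexive (∣⁅x⁆∣≡1 x))

  private
    CanForce : Subset n → Fin n → Fin n → Bool
    CanForce C y z = lookup C z ∧ D z y ∧ (uncoloredOut D C z ≤ᵇ k)

  forceStep-inflationary : ∀ C → C ⊆ forceStep D k C
  forceStep-inflationary C {y} y∈C = tabulate-∈⁺ (cong (_∨ any (CanForce C y) (allFin n)) ([]=⇒lookup y∈C))

  forceStep-forces : ∀ {C z y} → z ∈ C → D z y ≡ true → uncoloredOut D C z ≤ k →
                     y ∈ forceStep D k C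
  forceStep-forces {C} {z} {y} z∈C zy z-can = tabulate-∈⁺ (T⇒≡ (Equivalence.from T-∨ (inj₂
    (any⁺ (CanForce C y) (lose (∈-allFin z)
      (Equivalence.from (T-∧ {lookup C z}) (≡⇒T ([]=⇒lookup z∈C) , Equivalence.from T-∧ (≡⇒T zy , ≤⇒≤ᵇ z-can))))))))

  forceStep-reaches : ∀ {C y} → y ∈ forceStep D k C → y ∈ C ⊎ ∃[ z ] D z y ≡ true
  forceStep-reaches {C} {y} y∈ with Equivalence.to T-∨ (≡⇒T (tabulate-∈⁻ y∈))
  ... | inj₁ y∈C   = inj₁ (lookup⇒[]= y C (T⇒≡ y∈C))
  ... | inj₂ force =
    let z , z-forces = satisfied (any⁻ (CanForce C y) (allFin n) force)
    in inj₂ (z , T⇒≡ (proj₁ (Equivalence.to T-∧ (proj₂ (Equivalence.to (T-∧ {lookup C z}) z-forces)))))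

  ClosedOn : Subset n → Subset n → Set
  ClosedOn W X = ∀ {z y} → z ∈ W → z ∈ X → D z y ≡ true → uncoloredOut D X z ≤ k → y ∈ X

  -- Relative forcing: vertices outside W count as coloured but may not force.
  -- Since the forcing process stops at the least closed superset of S, this is
  -- ordinary forcing when W = ⊤.
  ForcesWithin : Subset n → Subset n → Set
  ForcesWithin W S = ∀ {X} → S ⊆ X → (∀ {x} → x ∉ W → x ∈ X) → ClosedOn W X → allColored X

  fixpoint⇒closedOn : ∀ {W C} → forceStep D k C ⊆ C → ClosedOn W C
  fixpoint⇒closedOn fixpoint _ z∈C zy z-can = fixpoint (forceStep-forces z∈C zy z-can)

  forcesWithin⊤⇒isForcingSet : 1 ≤ n → ∀ {S} → ForcesWithin ⊤ S → IsForcingSet D k S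
  forcesWithin⊤⇒isForcingSet 1≤n {S} forces = nonempty , t , allColored-Cₜ
    where
    nonempty : Nonempty S
    nonempty with nonempty? S
    ... | yes ne = ne
    ... | no  empty = ⊥-elim (∉⊥ (forces (λ x∈S → ⊥-elim (empty (_ , x∈S)))
                                  (λ x∉⊤ → ⊥-elim (x∉⊤ ∈⊤)) (λ _ z∈⊥ → ⊥-elim (∉⊥ z∈⊥)) (fromℕ< 1≤n)))
    fixpoint = inflationary⇒fixpoint (forceStep D k) forceStep-inflationary S
    t = proj₁ fixpoint
    allColored-Cₜ = forces (⊆-iterate (forceStep D k) forceStep-inflationary t S)
                           (λ x∉⊤ → ⊥-elim (x∉⊤ ∈⊤)) (fixpoint⇒closedOn (proj₂ fixpoint))

  source-never-forced : ∀ {S v} → (∀ u → D u v ≡ false) → ∀ t →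
                        v ∈ iterate (forceStep D k) t S → v ∈ S
  source-never-forced source zero    v∈ = v∈
  source-never-forced source (suc t) v∈ with forceStep-reaches v∈
  ... | inj₁ v∈Cₜ    = source-never-forced source t v∈Cₜ
  ... | inj₂ (u , uv) with () ← trans (sym uv) (source u)

  sources⊆forcingSet : ∀ {I S} → (∀ {v} → v ∈ I → ∀ u → D u v ≡ false) →
                       IsForcingSet D k S → I ⊆ S
  sources⊆forcingSet sources (_ , t , all) v∈I = source-never-forced (sources v∈I) t (all _)

module _ {n : ℕ} (G : Graph n) where

  rankOrientation : (Fin n → ℕ) → Fin n → Fin n → Bool
  rankOrientation rank u v = adj G u v ∧ (rank u <ᵇ rank v)

  private
    <ᵇ-xor : ∀ a b → a ≢ b → (a <ᵇ b) xor (b <ᵇ a) ≡ true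
    <ᵇ-xor zero    zero    a≢b = ⊥-elim (a≢b refl)
    <ᵇ-xor zero    (suc b) _   = refl
    <ᵇ-xor (suc a) zero    _   = refl
    <ᵇ-xor (suc a) (suc b) a≢b = <ᵇ-xor a b (a≢b ∘ cong suc)

  rankOrientation-isOrientation : ∀ rank → (∀ {u v} → adj G u v ≡ true → rank u ≢ rank v) →
                                  IsOrientation G (rankOrientation rank)
  rankOrientation-isOrientation rank separates =
    (λ u v → ∧-conicalˡ (adj G u v) _) ,
    λ u v uv → subst₂ (λ a b → (a ∧ (rank u <ᵇ rank v)) xor (b ∧ (rank v <ᵇ rank u)) ≡ true)
                 (sym uv) (sym (adj-sym G uv)) (<ᵇ-xor (rank u) (rank v) (separates uv))

  rankOrientation-source : ∀ rank {v} → rank v ≡ 0 → ∀ u → rankOrientation rank u v ≡ false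
  rankOrientation-source rank {v} rv≡0 u rewrite rv≡0 = ∧-zeroʳ (adj G u v)

  module _ (I : Subset n) (independent : Independent G I) where

    sourceRank : Fin n → ℕ
    sourceRank u = if lookup I u then 0 else suc (toℕ u)

    sourceRank-separates : ∀ {u v} → adj G u v ≡ true → sourceRank u ≢ sourceRank v
    sourceRank-separates {u} {v} uv with lookup I u in u∈I | lookup I v in v∈I
    ... | true  | true  = λ _ → contradiction
      (trans (sym uv) (independent u v (lookup⇒[]= u I u∈I) (lookup⇒[]= v I v∈I))) λ ()
    ... | true  | false = λ ()
    ... | false | true  = λ ()
    ... | false | false = λ r≡r → adj⇒≢ G uv (Fin.toℕ-injective (suc-injective r≡r))

    sourceOrientation : Fin n → Fin n → Bool
    sourceOrientation = rankOrientation sourceRank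

    sourceOrientation-isOrientation : IsOrientation G sourceOrientation
    sourceOrientation-isOrientation = rankOrientation-isOrientation sourceRank sourceRank-separates

    ∣I∣≤∣forcingSet∣ : ∀ {k S} → IsForcingSet sourceOrientation k S → ∣ I ∣ ≤ ∣ S ∣
    ∣I∣≤∣forcingSet∣ {k} forcingSet = p⊆q⇒∣p∣≤∣q∣ (Forcing.sources⊆forcingSet sourceOrientation k {I}
      (λ {v} v∈I → rankOrientation-source sourceRank (cong (if_then 0 else suc (toℕ v)) ([]=⇒lookup v∈I)))
      forcingSet)

module UpperBound {n : ℕ} (G : Graph n) (acyclic : Acyclic G)
  {D : Fin n → Fin n → Bool} (orientation : IsOrientation G D) {k : ℕ} (1≤k : 1 ≤ k) where

  open Forcing D k
  open PendantEdge

  arc⇒adj : ∀ {u v} → D u v ≡ true → adj G u v ≡ true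
  arc⇒adj = proj₁ orientation _ _

  reverseArc : ∀ {u v} → adj G u v ≡ true → D v u ≡ false → D u v ≡ true
  reverseArc {u} {v} uv vu = begin
    D u v              ≡⟨ xor-identityʳ (D u v) ⟨
    D u v xor false    ≡⟨ cong (D u v xor_) vu ⟨
    D u v xor D v u    ≡⟨ proj₂ orientation u v uv ⟩
    true               ∎
    where open ≡-Reasoning

  record SmallForcingSet (W : Subset n) : Set where
    field
      forcing       : Subset n
      independent   : Subset n
      independent⊆W : independent ⊆ W
      isIndependent : Independent G independent
      ∣forcing∣≤∣independent∣ : ∣ forcing ∣ ≤ ∣ independent ∣
      forcesWithin  : ForcesWithin W forcing

  open SmallForcingSet

  edgeless : ∀ {W} → ¬ HasEdgeIn G W → SmallForcingSet W
  edgeless {W} noEdge = record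
    { forcing       = W
    ; independent   = W
    ; independent⊆W = λ u∈W → u∈W
    ; isIndependent = λ u v u∈W v∈W → ¬-not λ uv → noEdge (u , v , u∈W , v∈W , uv)
    ; ∣forcing∣≤∣independent∣ = ≤-refl
    ; forcesWithin  = λ W⊆X outside⊆X _ x → [ W⊆X , outside⊆X ]′ (toSum (x ∈? W))
    }

  module LeafRemoval {W : Subset n} (e : PendantEdge G W) where

    private
      u = stem e
      v = leaf e

    W′ : Subset n
    W′ = W - u - v

    ∈W′⁺ : ∀ {x} → x ∈ W → x ≢ u → x ≢ v → x ∈ W′
    ∈W′⁺ x∈W x≢u x≢v = x∈p∧x≢y⇒x∈p-y (x∈p∧x≢y⇒x∈p-y x∈W x≢u) x≢v

    W′⊆W : W′ ⊆ W
    W′⊆W = p─q⊆p W ⁅ u ⁆ ∘ p─q⊆p (W - u) ⁅ v ⁆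

    ∈W′⇒≢stem : ∀ {x} → x ∈ W′ → x ≢ u
    ∈W′⇒≢stem x∈W′ = x∉⁅y⁆⇒x≢y (x∈p─q⇒x∉q W ⁅ u ⁆ (p─q⊆p (W - u) ⁅ v ⁆ x∈W′))

    ∈W′⇒≢leaf : ∀ {x} → x ∈ W′ → x ≢ v
    ∈W′⇒≢leaf x∈W′ = x∉⁅y⁆⇒x≢y (x∈p─q⇒x∉q (W - u) ⁅ v ⁆ x∈W′)

    ∣W′∣<∣W∣ : ∣ W′ ∣ < ∣ W ∣
    ∣W′∣<∣W∣ = <-≤-trans (x∈p⇒∣p-x∣<∣p∣ (x∈p∧x≢y⇒x∈p-y (leaf∈W e) (adj⇒≢ G (stem~leaf e) ∘ sym)))
                         (∣p─q∣≤∣p∣ W ⁅ u ⁆)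

    leaf-nonadjacent : ∀ {x} → x ∈ W′ → adj G v x ≡ false
    leaf-nonadjacent x∈W′ = ¬-not λ vx → ∈W′⇒≢stem x∈W′ (leaf-only e (W′⊆W x∈W′) vx)

    module _ {X : Subset n} (outside⊆X : ∀ {x} → x ∉ W → x ∈ X) (closed : ClosedOn W X) where

      private
        X′ : Subset n
        X′ = X ∪ ⁅ v ⁆

      uncolored⇒∈W : ∀ {w} → w ∉ X → w ∈ W
      uncolored⇒∈W {w} w∉X = decidable-stable (w ∈? W) (w∉X ∘ outside⊆X)

      outside⊆X′ : u ∈ X → ∀ {x} → x ∉ W′ → x ∈ X′
      outside⊆X′ u∈X {x} x∉W′ with x Fin.≟ v | x Fin.≟ u | x ∈? W
      ... | yes refl | _        | _        = q⊆p∪q X ⁅ v ⁆ (x∈⁅x⁆ v)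
      ... | no  _    | yes refl | _        = p⊆p∪q ⁅ v ⁆ u∈X
      ... | no  x≢v  | no  x≢u  | yes x∈W  = ⊥-elim (x∉W′ (∈W′⁺ x∈W x≢u x≢v))
      ... | no  _    | no  _    | no  x∉W  = p⊆p∪q ⁅ v ⁆ (outside⊆X x∉W)

      -- No vertex of W′ has an arc to the leaf, so adding it to X changes no count.
      closed′ : ClosedOn W′ X′
      closed′ {z} z∈W′ z∈X′ zy z-can = p⊆p∪q ⁅ v ⁆ (closed (W′⊆W z∈W′) z∈X zy
        (≤-trans (uncoloredOut-mono still-uncolored) z-can))
        where
        z∈X : z ∈ X
        z∈X = [ id , ⊥-elim ∘ ∈W′⇒≢leaf z∈W′ ∘ x∈⁅y⁆⇒x≡y v ]′ (x∈p∪q⁻ X ⁅ v ⁆ z∈X′)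
        still-uncolored : ∀ {w} → D z w ≡ true → w ∉ X → w ∉ X′
        still-uncolored zw w∉X w∈X′ with x∈p∪q⁻ X ⁅ v ⁆ w∈X′
        ... | inj₁ w∈X   = w∉X w∈X
        ... | inj₂ w∈⁅v⁆ rewrite x∈⁅y⁆⇒x≡y v w∈⁅v⁆ =
          ∈W′⇒≢stem z∈W′ (leaf-only e (W′⊆W z∈W′) (adj-sym G (arc⇒adj zw)))

      allButLeaf : ∀ {S′} → ForcesWithin W′ S′ → S′ ⊆ X → u ∈ X → ∀ {w} → w ≢ v → w ∈ X
      allButLeaf forces′ S′⊆X u∈X {w} w≢v = [ id , ⊥-elim ∘ w≢v ∘ x∈⁅y⁆⇒x≡y v ]′
        (x∈p∪q⁻ X ⁅ v ⁆ (forces′ (p⊆p∪q ⁅ v ⁆ ∘ S′⊆X) (outside⊆X′ u∈X) closed′ w))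

    module _ {S′ : Subset n} (forces′ : ForcesWithin W′ S′) where

      forcesWithin-fromLeaf : D v u ≡ true → ForcesWithin W (⁅ v ⁆ ∪ S′)
      forcesWithin-fromLeaf vu {X} S⊆X outside⊆X closed = all
        where
        v∈X : v ∈ X
        v∈X = S⊆X (p⊆p∪q S′ (x∈⁅x⁆ v))
        only-stem : ∀ {w} → D v w ≡ true → w ∉ X → w ≡ u
        only-stem vw w∉X = leaf-only e (uncolored⇒∈W outside⊆X closed w∉X) (arc⇒adj vw)
        u∈X : u ∈ X
        u∈X = closed (leaf∈W e) v∈X vu (≤-trans (uncoloredOut≤1 u only-stem) 1≤k)
        all : allColored X
        all w with w Fin.≟ v
        ... | yes refl = v∈X
        ... | no  w≢v  = allButLeaf outside⊆X closed forces′ (S⊆X ∘ q⊆p∪q ⁅ v ⁆ S′) u∈X w≢v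

      forcesWithin-fromStem : D u v ≡ true → ForcesWithin W (⁅ u ⁆ ∪ S′)
      forcesWithin-fromStem uv {X} S⊆X outside⊆X closed = all
        where
        u∈X : u ∈ X
        u∈X = S⊆X (p⊆p∪q S′ (x∈⁅x⁆ u))
        allButLeaf′ : ∀ {w} → w ≢ v → w ∈ X
        allButLeaf′ = allButLeaf outside⊆X closed forces′ (S⊆X ∘ q⊆p∪q ⁅ u ⁆ S′) u∈X
        only-leaf : ∀ {w} → D u w ≡ true → w ∉ X → w ≡ v
        only-leaf {w} _ w∉X = decidable-stable (w Fin.≟ v) (w∉X ∘ allButLeaf′)
        all : allColored X
        all w with w Fin.≟ v
        ... | yes refl = closed (stem∈W e) u∈X uv (≤-trans (uncoloredOut≤1 v only-leaf) 1≤k)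
        ... | no  w≢v  = allButLeaf′ w≢v

    addLeaf : (F : SmallForcingSet W′) → ∀ x → ForcesWithin W (⁅ x ⁆ ∪ forcing F) → SmallForcingSet W
    addLeaf F x forces = record
      { forcing       = ⁅ x ⁆ ∪ forcing F
      ; independent   = ⁅ v ⁆ ∪ independent F
      ; independent⊆W = [ (λ a∈⁅v⁆ → subst (_∈ W) (sym (x∈⁅y⁆⇒x≡y v a∈⁅v⁆)) (leaf∈W e))
                        , W′⊆W ∘ independent⊆W F ]′ ∘ x∈p∪q⁻ ⁅ v ⁆ (independent F)
      ; isIndependent = isIndependent′
      ; ∣forcing∣≤∣independent∣ = count
      ; forcesWithin  = forces
      }
      where
      isIndependent′ : Independent G (⁅ v ⁆ ∪ independent F)
      isIndependent′ a b a∈ b∈ with x∈p∪q⁻ ⁅ v ⁆ (independent F) a∈ | x∈p∪q⁻ ⁅ v ⁆ (independent F) b∈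
      ... | inj₁ a∈⁅v⁆ | inj₁ b∈⁅v⁆ rewrite x∈⁅y⁆⇒x≡y v a∈⁅v⁆ | x∈⁅y⁆⇒x≡y v b∈⁅v⁆ = irref G v
      ... | inj₁ a∈⁅v⁆ | inj₂ b∈I   rewrite x∈⁅y⁆⇒x≡y v a∈⁅v⁆ =
        leaf-nonadjacent (independent⊆W F b∈I)
      ... | inj₂ a∈I   | inj₁ b∈⁅v⁆ rewrite x∈⁅y⁆⇒x≡y v b∈⁅v⁆ =
        trans (Graph.sym G a v) (leaf-nonadjacent (independent⊆W F a∈I))
      ... | inj₂ a∈I   | inj₂ b∈I   = isIndependent F a b a∈I b∈I
      I⊂I′ : independent F ⊂ ⁅ v ⁆ ∪ independent F
      I⊂I′ = q⊆p∪q ⁅ v ⁆ (independent F) , v , p⊆p∪q (independent F) (x∈⁅x⁆ v) ,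
             λ v∈I → ∈W′⇒≢leaf (independent⊆W F v∈I) refl
      count : ∣ ⁅ x ⁆ ∪ forcing F ∣ ≤ ∣ ⁅ v ⁆ ∪ independent F ∣
      count = begin
        ∣ ⁅ x ⁆ ∪ forcing F ∣        ≤⟨ ∣p∪q∣≤∣p∣+∣q∣ ⁅ x ⁆ (forcing F) ⟩
        ∣ ⁅ x ⁆ ∣ + ∣ forcing F ∣    ≡⟨ cong (_+ ∣ forcing F ∣) (∣⁅x⁆∣≡1 x) ⟩
        suc ∣ forcing F ∣            ≤⟨ s≤s (∣forcing∣≤∣independent∣ F) ⟩
        suc ∣ independent F ∣        ≤⟨ p⊂q⇒∣p∣<∣q∣ I⊂I′ ⟩
        ∣ ⁅ v ⁆ ∪ independent F ∣    ∎
        where open ≤-Reasoning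

    reattachLeaf : SmallForcingSet W′ → SmallForcingSet W
    reattachLeaf F with D v u in vu
    ... | true  = addLeaf F v (forcesWithin-fromLeaf (forcesWithin F) vu)
    ... | false = addLeaf F u (forcesWithin-fromStem (forcesWithin F) (reverseArc (stem~leaf e) vu))

  smallForcingSet : ∀ W → Acc _<_ ∣ W ∣ → SmallForcingSet W
  smallForcingSet W (acc smaller) with hasEdgeIn? G W
  ... | no  noEdge = edgeless noEdge
  ... | yes edge   = reattachLeaf (smallForcingSet W′ (smaller ∣W′∣<∣W∣))
    where open LeafRemoval (acyclic⇒pendantEdge G acyclic edge)

  acyclic⇒smallForcingSet : 1 ≤ n →
    Σ (Subset n) λ S → IsForcingSet D k S × Σ (Subset n) λ I → Independent G I × ∣ S ∣ ≤ ∣ I ∣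
  acyclic⇒smallForcingSet 1≤n =
    forcing F , forcesWithin⊤⇒isForcingSet 1≤n (forcesWithin F) ,
    independent F , isIndependent F , ∣forcing∣≤∣independent∣ F
    where F = smallForcingSet ⊤ (<-wellFounded _)

corollary3p24 : ∀ {n} (T : Graph n) → IsTree T →
    ∀ (k : ℕ) → 1 ≤ k → ∀ (a : ℕ) → IsIndependenceNumber T a → IsMOF T k a
corollary3p24 {n} T (1≤n , _ , acyclic) k 1≤k a ((I , independent , ∣I∣≡a) , maximum) =
  (D₀ , sourceOrientation-isOrientation T I independent , F₀≡a) ,
  λ D orientation m (_ , minimum) →
    let S , forcing , ∣S∣≤a = forcingSet≤a orientation in ≤-trans (minimum S forcing) ∣S∣≤a
  where
  D₀ = sourceOrientation T I independent

  a≤ : ∀ {S} → IsForcingSet D₀ k S → a ≤ ∣ S ∣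
  a≤ forcing = subst (_≤ _) ∣I∣≡a (∣I∣≤∣forcingSet∣ T I independent forcing)

  forcingSet≤a : ∀ {D} → IsOrientation T D → Σ (Subset n) λ S → IsForcingSet D k S × ∣ S ∣ ≤ a
  forcingSet≤a orientation =
    let S , forcing , J , J-independent , ∣S∣≤∣J∣ = UpperBound.acyclic⇒smallForcingSet T acyclic orientation 1≤k 1≤n
    in S , forcing , ≤-trans ∣S∣≤∣J∣ (maximum J J-independent)

  F₀≡a : IsFk D₀ k a
  F₀≡a with forcingSet≤a (sourceOrientation-isOrientation T I independent)
  ... | S , forcing , ∣S∣≤a = (S , forcing , ≤-antisym ∣S∣≤a (a≤ forcing)) , λ _ → a≤
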